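{- For all $e\geq 1$, the twisted Stern sequence satisfies $$\sum_{n=0}^{3\cdot 2^e}t(n)z^n=z-z^2+\sum_{k=0}^{e-1}(-1)^kz^{3\cdot 2^k+1}(z^{2^k}+1)\prod_{i=0}^{k-1}(1+z^{2^i}+z^{2^{i+1}}).$$
   Context: The twisted Stern sequence is defined by $t(0)=0$, $t(1)=1$, and for $n\ge1$, $t(2n)=-t(n)$, $t(2n+1)=-t(n)-t(n+1)$. An empty product equals $1$. -}

module Defs where

open import Data.Nat as ℕ using (ℕ; zero; suc)
open import Data.Nat.DivMod using (_/_; _%_)
open import Data.Integer using (ℤ; +_; -_; _+_; _-_; _*_)
open import Relation.Binary.PropositionalEquality using (_≡_; refl)

-- Twisted Stern sequence, defined by fuel-bounded recursion.
-- tF k n is correct whenever k > n (children of n ≥ 2 are ≤ n/2+1 ≤ n-1... and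
-- the fuel k = n+1 always suffices).
tF : ℕ → ℕ → ℤ
tF zero _ = + 0
tF (suc k) zero = + 0
tF (suc k) (suc zero) = + 1
tF (suc k) n@(suc (suc m)) with n % 2
... | zero = - tF k (n / 2)
... | suc _ = - tF k (n / 2) - tF k (suc (n / 2))

t : ℕ → ℤ
t n = tF (suc n) n

sumTo : ℕ → (ℕ → ℤ) → ℤ
sumTo zero f = + 0
sumTo (suc N) f = sumTo N f + f N

prodTo : ℕ → (ℕ → ℤ) → ℤ
prodTo zero f = + 1
prodTo (suc N) f = prodTo N f * f N

private
  c2 : t 2 ≡ - (+ 1)
  c2 = refl
  c3 : t 3 ≡ + 0
  c3 = refl
  c5 : t 5 ≡ + 1
  c5 = refl
  c6 : t 6 ≡ + 0
  c6 = refl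
  c7 : t 7 ≡ - (+ 1)
  c7 = refl

module Submission where

-- Write N_e = 3·2^e and let block_e(z) = Σ_{j < N_e} t(N_e + 1 + j) zʲ collect the
-- coefficients strictly between N_e and N_{e+1} = 2N_e.  Then
--   Σ_{n ≤ N_{e+1}} t(n) zⁿ = Σ_{n ≤ N_e} t(n) zⁿ + z^{N_e+1} block_e(z),
-- so the theorem follows by induction on e once block_e has the closed form
--   block_e(z) = (-1)^e (z^{2^e} + 1) ∏_{i<e} (1 + z^{2^i} + z^{2^{i+1}}).
-- That closed form follows from the functional equation
--   block_{e+1}(z) = -(1 + z + z²) block_e(z²),
-- obtained by grouping the indices of block_{e+1} in even/odd pairs and applying
-- t(2n) = -t(n), t(2n+1) = -t(n) - t(n+1); the boundary terms vanish since t(N_e) = 0.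
-- The file first derives these two recursion equations from the fuel-bounded
-- definition of t, then collects elementary facts about finite sums and products,
-- and finally develops the blocks.  The identity also holds for e = 0.

open import Defs
open import Data.Nat as ℕ using (ℕ; zero; suc; _≤_; _<_; s≤s)
open import Data.Nat.Properties
  using (m≤m*n; <-≤-trans; <-trans; n<1+n; ≤-refl; +-comm; +-suc; +-identityʳ; *-comm)
open import Data.Nat.DivMod using (_/_; _%_; m*n%n≡0; m*n/n≡m; [m+kn]%n≡m%n; +-distrib-/)
open import Data.Integer using (ℤ; +_; -_; _+_; _-_; _*_; _^_)
open import Data.Integer.Properties using (^-distribˡ-+-*; ^-*-assoc; ^-identityʳ; *-zeroʳ; *-zeroˡ)
  renaming ( +-assoc to ℤ+-assoc; +-identityʳ to ℤ+-identityʳ; +-identityˡ to ℤ+-identityˡ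
           ; *-comm to ℤ*-comm; *-assoc to ℤ*-assoc)
import Data.Integer.Tactic.RingSolver as ℤ-Ring
import Data.Nat.Tactic.RingSolver as ℕ-Ring
open import Data.Product using (∃-syntax; _,_)
open import Data.Sum using (_⊎_; inj₁; inj₂)
open import Relation.Binary.PropositionalEquality
  using (_≡_; refl; sym; trans; cong; cong₂; subst; module ≡-Reasoning)

open ≡-Reasoning

even-or-odd : ∀ m → ∃[ q ] (m ≡ q ℕ.* 2 ⊎ m ≡ suc (q ℕ.* 2))
even-or-odd zero = 0 , inj₁ refl
even-or-odd (suc m) with even-or-odd m
... | q , inj₁ refl = q , inj₂ refl
... | q , inj₂ refl = suc q , inj₁ refl

odd/2 : ∀ q → suc (q ℕ.* 2) / 2 ≡ q
odd/2 q = begin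
  (1 ℕ.+ q ℕ.* 2) / 2     ≡⟨ +-distrib-/ 1 (q ℕ.* 2) 1+0<2 ⟩
  1 / 2 ℕ.+ q ℕ.* 2 / 2   ≡⟨ m*n/n≡m q 2 ⟩
  q                       ∎
  where
    1+0<2 : 1 % 2 ℕ.+ q ℕ.* 2 % 2 < 2
    1+0<2 = subst (λ r → 1 % 2 ℕ.+ r < 2) (sym (m*n%n≡0 q 2)) (s≤s (s≤s ℕ.z≤n))

tF-even : ∀ k q → tF (suc k) (suc q ℕ.* 2) ≡ - tF k (suc q)
tF-even k q rewrite m*n%n≡0 (suc q) 2 ⦃ ℕ.nonZero ⦄ | m*n/n≡m (suc q) 2 ⦃ ℕ.nonZero ⦄ = refl

tF-odd : ∀ k q → tF (suc k) (suc (suc q ℕ.* 2)) ≡ - tF k (suc q) - tF k (suc (suc q))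
tF-odd k q rewrite [m+kn]%n≡m%n 1 (suc q) 2 ⦃ ℕ.nonZero ⦄ | odd/2 (suc q) = refl

half<even : ∀ q → suc q < suc q ℕ.* 2
half<even q = s≤s (s≤s (m≤m*n q 2))

half<odd : ∀ q → suc (suc q) < suc (suc q ℕ.* 2)
half<odd q = s≤s (s≤s (s≤s (m≤m*n q 2)))

tF-fuel-irrelevant : ∀ k k′ n → n < k → n < k′ → tF k n ≡ tF k′ n
tF-fuel-irrelevant (suc k) (suc k′) zero _ _ = refl
tF-fuel-irrelevant (suc k) (suc k′) (suc zero) _ _ = refl
tF-fuel-irrelevant (suc k) (suc k′) (suc (suc m)) (s≤s n≤k) (s≤s n≤k′) with even-or-odd m
... | q , inj₁ refl = begin
  tF (suc k) (suc q ℕ.* 2)    ≡⟨ tF-even k q ⟩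
  - tF k (suc q)              ≡⟨ cong -_ (irr (half<even q)) ⟩
  - tF k′ (suc q)             ≡⟨ sym (tF-even k′ q) ⟩
  tF (suc k′) (suc q ℕ.* 2)   ∎
  where
    irr : ∀ {c} → c < suc q ℕ.* 2 → tF k c ≡ tF k′ c
    irr c<n = tF-fuel-irrelevant k k′ _ (<-≤-trans c<n n≤k) (<-≤-trans c<n n≤k′)
... | q , inj₂ refl = begin
  tF (suc k) (suc (suc q ℕ.* 2))                 ≡⟨ tF-odd k q ⟩
  - tF k (suc q) - tF k (suc (suc q))            ≡⟨ cong₂ _-_ (cong -_ (irr (<-trans (n<1+n _) (half<odd q))))
                                                              (irr (half<odd q)) ⟩
  - tF k′ (suc q) - tF k′ (suc (suc q))          ≡⟨ sym (tF-odd k′ q) ⟩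
  tF (suc k′) (suc (suc q ℕ.* 2))                ∎
  where
    irr : ∀ {c} → c < suc (suc q ℕ.* 2) → tF k c ≡ tF k′ c
    irr c<n = tF-fuel-irrelevant k k′ _ (<-≤-trans c<n n≤k) (<-≤-trans c<n n≤k′)

t-even : ∀ q → t (suc q ℕ.* 2) ≡ - t (suc q)
t-even q = trans (tF-even _ q) (cong -_ (tF-fuel-irrelevant _ _ (suc q) (half<even q) ≤-refl))

t-odd : ∀ q → t (suc (suc q ℕ.* 2)) ≡ - t (suc q) - t (suc (suc q))
t-odd q = trans (tF-odd _ q)
  (cong₂ _-_ (cong -_ (tF-fuel-irrelevant _ _ (suc q) (<-trans (n<1+n _) (half<odd q)) ≤-refl))
             (tF-fuel-irrelevant _ _ (suc (suc q)) (half<odd q) ≤-refl))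

sumTo-cong : ∀ M {f g : ℕ → ℤ} → (∀ i → f i ≡ g i) → sumTo M f ≡ sumTo M g
sumTo-cong zero f≡g = refl
sumTo-cong (suc M) f≡g = cong₂ _+_ (sumTo-cong M f≡g) (f≡g M)

prodTo-cong : ∀ M {f g : ℕ → ℤ} → (∀ i → f i ≡ g i) → prodTo M f ≡ prodTo M g
prodTo-cong zero f≡g = refl
prodTo-cong (suc M) f≡g = cong₂ _*_ (prodTo-cong M f≡g) (f≡g M)

sumTo-+ : ∀ M (f g : ℕ → ℤ) → sumTo M (λ i → f i + g i) ≡ sumTo M f + sumTo M g
sumTo-+ zero f g = refl
sumTo-+ (suc M) f g = begin
  sumTo M (λ i → f i + g i) + (f M + g M)   ≡⟨ cong (_+ (f M + g M)) (sumTo-+ M f g) ⟩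
  sumTo M f + sumTo M g + (f M + g M)       ≡⟨ interchange (sumTo M f) (sumTo M g) (f M) (g M) ⟩
  sumTo M f + f M + (sumTo M g + g M)       ∎
  where
    interchange : ∀ a b c d → a + b + (c + d) ≡ a + c + (b + d)
    interchange = ℤ-Ring.solve-∀

sumTo-scale : ∀ M c (f : ℕ → ℤ) → sumTo M (λ i → c * f i) ≡ c * sumTo M f
sumTo-scale zero c f = sym (*-zeroʳ c)
sumTo-scale (suc M) c f = begin
  sumTo M (λ i → c * f i) + c * f M   ≡⟨ cong (_+ c * f M) (sumTo-scale M c f) ⟩
  c * sumTo M f + c * f M             ≡⟨ distrib c (sumTo M f) (f M) ⟩
  c * (sumTo M f + f M)               ∎
  where
    distrib : ∀ c a b → c * a + c * b ≡ c * (a + b)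
    distrib = ℤ-Ring.solve-∀

sumTo-++ : ∀ a b (f : ℕ → ℤ) → sumTo (a ℕ.+ b) f ≡ sumTo a f + sumTo b (λ j → f (a ℕ.+ j))
sumTo-++ a zero f = trans (cong (λ n → sumTo n f) (+-identityʳ a)) (sym (ℤ+-identityʳ _))
sumTo-++ a (suc b) f = begin
  sumTo (a ℕ.+ suc b) f                                        ≡⟨ cong (λ n → sumTo n f) (+-suc a b) ⟩
  sumTo (a ℕ.+ b) f + f (a ℕ.+ b)                              ≡⟨ cong (_+ f (a ℕ.+ b)) (sumTo-++ a b f) ⟩
  sumTo a f + sumTo b (λ j → f (a ℕ.+ j)) + f (a ℕ.+ b)        ≡⟨ ℤ+-assoc (sumTo a f) _ (f (a ℕ.+ b)) ⟩
  sumTo a f + (sumTo b (λ j → f (a ℕ.+ j)) + f (a ℕ.+ b))      ∎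

sumTo-first : ∀ M (f : ℕ → ℤ) → sumTo (suc M) f ≡ f 0 + sumTo M (λ j → f (suc j))
sumTo-first M f = trans (sumTo-++ 1 M f) (cong (_+ sumTo M (λ j → f (suc j))) (ℤ+-identityˡ (f 0)))

prodTo-first : ∀ M (f : ℕ → ℤ) → prodTo (suc M) f ≡ f 0 * prodTo M (λ j → f (suc j))
prodTo-first zero f = ℤ*-comm (+ 1) (f 0)
prodTo-first (suc M) f = begin
  prodTo (suc M) f * f (suc M)                          ≡⟨ cong (_* f (suc M)) (prodTo-first M f) ⟩
  f 0 * prodTo M (λ j → f (suc j)) * f (suc M)          ≡⟨ ℤ*-assoc (f 0) (prodTo M (λ j → f (suc j))) (f (suc M)) ⟩
  f 0 * (prodTo M (λ j → f (suc j)) * f (suc M))        ∎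

sumTo-pairs : ∀ M (f : ℕ → ℤ) → sumTo (M ℕ.* 2) f ≡ sumTo M (λ m → f (m ℕ.* 2) + f (suc (m ℕ.* 2)))
sumTo-pairs zero f = refl
sumTo-pairs (suc M) f = begin
  sumTo (M ℕ.* 2) f + f 2M + f (suc 2M)       ≡⟨ ℤ+-assoc (sumTo (M ℕ.* 2) f) (f 2M) (f (suc 2M)) ⟩
  sumTo (M ℕ.* 2) f + (f 2M + f (suc 2M))     ≡⟨ cong (_+ (f 2M + f (suc 2M))) (sumTo-pairs M f) ⟩
  sumTo M (λ m → f (m ℕ.* 2) + f (suc (m ℕ.* 2)))
    + (f 2M + f (suc 2M))                     ∎
  where
    2M : ℕ
    2M = M ℕ.* 2

-- Writing N e = 3·2^e as the successor of K e makes N (suc e) and N e * 2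
-- definitionally equal and keeps every N e visibly positive.
K : ℕ → ℕ
K zero = 2
K (suc e) = suc (K e ℕ.* 2)

N : ℕ → ℕ
N e = suc (K e)

N-closed : ∀ e → N e ≡ 3 ℕ.* 2 ℕ.^ e
N-closed zero = refl
N-closed (suc e) = trans (cong (ℕ._* 2) (N-closed e)) (triple-double (2 ℕ.^ e))
  where
    triple-double : ∀ x → 3 ℕ.* x ℕ.* 2 ≡ 3 ℕ.* (2 ℕ.* x)
    triple-double = ℕ-Ring.solve-∀

-- t vanishes at every N e: t(3) = 0 and t(2n) = -t(n).
t-N : ∀ e → t (N e) ≡ + 0
t-N zero = refl
t-N (suc e) = trans (t-even (K e)) (cong -_ (t-N e))

block : ℕ → ℤ → ℤ
block e z = sumTo (N e) (λ j → t (suc (N e ℕ.+ j)) * z ^ j)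

P : ℕ → ℤ → ℤ
P e z = prodTo e (λ i → + 1 + z ^ (2 ℕ.^ i) + z ^ (2 ℕ.^ suc i))

square-power : ∀ z m → z ^ (2 ℕ.* m) ≡ (z ^ 2) ^ m
square-power z m = sym (^-*-assoc z 2 m)

square-power′ : ∀ z m → z ^ (m ℕ.* 2) ≡ (z ^ 2) ^ m
square-power′ z m = trans (cong (z ^_) (*-comm m 2)) (square-power z m)

P-step : ∀ e z → P (suc e) z ≡ (+ 1 + z + z ^ 2) * P e (z ^ 2)
P-step e z = begin
  P (suc e) z                                         ≡⟨ prodTo-first e _ ⟩
  (+ 1 + z ^ 1 + z ^ 2) * prodTo e (λ i → + 1 + z ^ (2 ℕ.^ suc i) + z ^ (2 ℕ.^ suc (suc i)))
    ≡⟨ cong₂ (λ y p → (+ 1 + y + z ^ 2) * p) (^-identityʳ z) (prodTo-cong e squared-factor) ⟩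
  (+ 1 + z + z ^ 2) * P e (z ^ 2)                     ∎
  where
    squared-factor : ∀ i → + 1 + z ^ (2 ℕ.^ suc i) + z ^ (2 ℕ.^ suc (suc i))
                         ≡ + 1 + (z ^ 2) ^ (2 ℕ.^ i) + (z ^ 2) ^ (2 ℕ.^ suc i)
    squared-factor i = cong₂ (λ a b → + 1 + a + b) (square-power z (2 ℕ.^ i)) (square-power z (2 ℕ.^ suc i))

-- The block shifted back by one position: Σ_{m < N} t(N + m) wᵐ = w · block e w.
-- The boundary terms are t(N e) and t(2 N e), both zero.
block-shifted : ∀ e w → sumTo (N e) (λ m → t (N e ℕ.+ m) * w ^ m) ≡ w * block e w
block-shifted e w = begin
  sumTo (N e) F                               ≡⟨ sumTo-first (K e) F ⟩
  F 0 + sumTo (K e) (λ j → F (suc j))         ≡⟨ cong₂ _+_ first-term (sumTo-cong (K e) shift-term) ⟩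
  + 0 + sumTo (K e) (λ j → w * G j)           ≡⟨ cong (_+_ (+ 0)) (sumTo-scale (K e) w G) ⟩
  + 0 + w * sumTo (K e) G                     ≡⟨ append-zero w (sumTo (K e) G) ⟩
  w * (sumTo (K e) G + + 0)                   ≡⟨ cong (λ x → w * (sumTo (K e) G + x)) (sym last-term) ⟩
  w * block e w                               ∎
  where
    F G : ℕ → ℤ
    F m = t (N e ℕ.+ m) * w ^ m
    G j = t (suc (N e ℕ.+ j)) * w ^ j

    first-term : F 0 ≡ + 0
    first-term = trans (cong (λ n → t n * + 1) (+-identityʳ (N e))) (cong (_* + 1) (t-N e))

    shift-term : ∀ j → F (suc j) ≡ w * G j
    shift-term j = trans (cong (λ n → t n * w ^ suc j) (+-suc (N e) j))
                         (swap (t (suc (N e ℕ.+ j))) w (w ^ j))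
      where
        swap : ∀ a b c → a * (b * c) ≡ b * (a * c)
        swap = ℤ-Ring.solve-∀

    last-term : G (K e) ≡ + 0
    last-term = begin
      t (suc (N e ℕ.+ K e)) * w ^ K e   ≡⟨ cong (λ n → t (suc (suc n)) * w ^ K e) (double (K e)) ⟩
      t (N (suc e)) * w ^ K e           ≡⟨ cong (_* w ^ K e) (t-N (suc e)) ⟩
      + 0 * w ^ K e                     ≡⟨ *-zeroˡ (w ^ K e) ⟩
      + 0                               ∎
      where
        double : ∀ k → k ℕ.+ k ≡ k ℕ.* 2
        double = ℕ-Ring.solve-∀

    append-zero : ∀ w S → + 0 + w * S ≡ w * (S + + 0)
    append-zero = ℤ-Ring.solve-∀

-- Pair the coefficients of block (e+1) as t(2(N+m)+1), t(2(N+m+1)) and apply the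
-- recursion; what remains are two shifts of block e at w = z².
block-step : ∀ e z → block (suc e) z ≡ - (+ 1 + z + z ^ 2) * block e (z ^ 2)
block-step e z = begin
  block (suc e) z                                                ≡⟨ sumTo-pairs (N e) H ⟩
  sumTo (N e) (λ m → H (m ℕ.* 2) + H (suc (m ℕ.* 2)))            ≡⟨ sumTo-cong (N e) pair ⟩
  sumTo (N e) (λ m → (- + 1) * A m + - (+ 1 + z) * B m)          ≡⟨ sumTo-+ (N e) _ _ ⟩
  sumTo (N e) (λ m → (- + 1) * A m)
    + sumTo (N e) (λ m → - (+ 1 + z) * B m)                      ≡⟨ cong₂ _+_ (sumTo-scale (N e) (- + 1) A)
                                                                              (sumTo-scale (N e) (- (+ 1 + z)) B) ⟩
  (- + 1) * sumTo (N e) A + - (+ 1 + z) * block e w              ≡⟨ cong (λ s → (- + 1) * s + - (+ 1 + z) * block e w)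
                                                                         (block-shifted e w) ⟩
  (- + 1) * (w * block e w) + - (+ 1 + z) * block e w            ≡⟨ collect z w (block e w) ⟩
  - (+ 1 + z + w) * block e w                                    ∎
  where
    w : ℤ
    w = z ^ 2

    H A B : ℕ → ℤ
    H j = t (suc (N e ℕ.* 2 ℕ.+ j)) * z ^ j
    A m = t (N e ℕ.+ m) * w ^ m
    B m = t (suc (N e ℕ.+ m)) * w ^ m

    pair : ∀ m → H (m ℕ.* 2) + H (suc (m ℕ.* 2)) ≡ (- + 1) * A m + - (+ 1 + z) * B m
    pair m = begin
      H (m ℕ.* 2) + H (suc (m ℕ.* 2))
        ≡⟨ cong₂ (λ c d → c * z ^ (m ℕ.* 2) + d * (z * z ^ (m ℕ.* 2))) odd-coefficient even-coefficient ⟩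
      (- a - b) * z ^ (m ℕ.* 2) + - b * (z * z ^ (m ℕ.* 2))
        ≡⟨ cong (λ y → (- a - b) * y + - b * (z * y)) (square-power′ z m) ⟩
      (- a - b) * w ^ m + - b * (z * w ^ m)
        ≡⟨ regroup a b z (w ^ m) ⟩
      (- + 1) * A m + - (+ 1 + z) * B m
        ∎
      where
        a b : ℤ
        a = t (suc (K e ℕ.+ m))
        b = t (suc (suc (K e ℕ.+ m)))

        odd-coefficient : t (suc (N e ℕ.* 2 ℕ.+ m ℕ.* 2)) ≡ - a - b
        odd-coefficient = trans (cong t (odd-index (K e) m)) (t-odd (K e ℕ.+ m))
          where
            odd-index : ∀ k m → suc (suc k ℕ.* 2 ℕ.+ m ℕ.* 2) ≡ suc (suc (k ℕ.+ m) ℕ.* 2)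
            odd-index = ℕ-Ring.solve-∀

        even-coefficient : t (suc (N e ℕ.* 2 ℕ.+ suc (m ℕ.* 2))) ≡ - b
        even-coefficient = trans (cong t (even-index (K e) m)) (t-even (suc (K e ℕ.+ m)))
          where
            even-index : ∀ k m → suc (suc k ℕ.* 2 ℕ.+ suc (m ℕ.* 2)) ≡ suc (suc (k ℕ.+ m)) ℕ.* 2
            even-index = ℕ-Ring.solve-∀

        regroup : ∀ a b z y → (- a - b) * y + - b * (z * y) ≡ (- + 1) * (a * y) + - (+ 1 + z) * (b * y)
        regroup = ℤ-Ring.solve-∀

    collect : ∀ z w Q → (- + 1) * (w * Q) + - (+ 1 + z) * Q ≡ - (+ 1 + z + w) * Q
    collect = ℤ-Ring.solve-∀

block-closed : ∀ e z → block e z ≡ (- + 1) ^ e * (z ^ (2 ℕ.^ e) + + 1) * P e z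
block-closed zero z = initial-block (z ^ 1) (z ^ 2)
  where
    -- block 0 z = t(4) + t(5) z + t(6) z² with t(4) = t(5) = 1, t(6) = 0.
    initial-block : ∀ y w → + 0 + + 1 * + 1 + + 1 * y + + 0 * w ≡ + 1 * (y + + 1) * + 1
    initial-block = ℤ-Ring.solve-∀
block-closed (suc e) z = begin
  block (suc e) z                                           ≡⟨ block-step e z ⟩
  - (+ 1 + z + w) * block e w                               ≡⟨ cong (- (+ 1 + z + w) *_) (block-closed e w) ⟩
  - (+ 1 + z + w) * (s * (w ^ (2 ℕ.^ e) + + 1) * P e w)     ≡⟨ regroup z w s (w ^ (2 ℕ.^ e)) (P e w) ⟩
  (- + 1) * s * (w ^ (2 ℕ.^ e) + + 1) * ((+ 1 + z + w) * P e w)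
    ≡⟨ sym (cong₂ (λ y p → (- + 1) * s * (y + + 1) * p) (square-power z (2 ℕ.^ e)) (P-step e z)) ⟩
  (- + 1) ^ suc e * (z ^ (2 ℕ.^ suc e) + + 1) * P (suc e) z ∎
  where
    w s : ℤ
    w = z ^ 2
    s = (- + 1) ^ e

    regroup : ∀ z w s y p → - (+ 1 + z + w) * (s * (y + + 1) * p) ≡ (- + 1) * s * (y + + 1) * ((+ 1 + z + w) * p)
    regroup = ℤ-Ring.solve-∀

upper-half : ∀ e z → sumTo (N e) (λ j → t (suc (N e) ℕ.+ j) * z ^ (suc (N e) ℕ.+ j))
                     ≡ z ^ suc (N e) * block e z
upper-half e z = trans (sumTo-cong (N e) factor-power) (sumTo-scale (N e) (z ^ suc (N e)) _)
  where
    factor-power : ∀ j → t (suc (N e) ℕ.+ j) * z ^ (suc (N e) ℕ.+ j)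
                         ≡ z ^ suc (N e) * (t (suc (N e ℕ.+ j)) * z ^ j)
    factor-power j = trans (cong (t (suc (N e ℕ.+ j)) *_) (^-distribˡ-+-* z (suc (N e)) j))
                           (swap (t (suc (N e ℕ.+ j))) (z ^ suc (N e)) (z ^ j))
      where
        swap : ∀ a b c → a * (b * c) ≡ b * (a * c)
        swap = ℤ-Ring.solve-∀

summand : ℤ → ℕ → ℤ
summand z k = (- + 1) ^ k * z ^ (3 ℕ.* 2 ℕ.^ k ℕ.+ 1) * (z ^ (2 ℕ.^ k) + + 1) * P k z

partial-sum : ∀ e z → sumTo (suc (N e)) (λ n → t n * z ^ n) ≡ z - z ^ 2 + sumTo e (summand z)
partial-sum zero z = initial-sum z (z ^ 2) (z ^ 3)
  where
    -- t(0), …, t(3) = 0, 1, -1, 0; here z ^ 1 unfolds to z * + 1.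
    initial-sum : ∀ z w v → + 0 + + 0 * + 1 + + 1 * (z * + 1) + (- + 1) * w + + 0 * v ≡ z - w + + 0
    initial-sum = ℤ-Ring.solve-∀
partial-sum (suc e) z = begin
  sumTo (suc (N e ℕ.* 2)) g                                     ≡⟨ cong (λ n → sumTo n g) (double (K e)) ⟩
  sumTo (suc (N e) ℕ.+ N e) g                                   ≡⟨ sumTo-++ (suc (N e)) (N e) g ⟩
  sumTo (suc (N e)) g + sumTo (N e) (λ j → g (suc (N e) ℕ.+ j)) ≡⟨ cong₂ _+_ (partial-sum e z) (upper-half e z) ⟩
  z - z ^ 2 + R + z ^ suc (N e) * block e z                     ≡⟨ cong₂ (λ n b → z - z ^ 2 + R + z ^ n * b)
                                                                         exponent (block-closed e z) ⟩
  z - z ^ 2 + R + z ^ (3 ℕ.* 2 ℕ.^ e ℕ.+ 1) * (s * y * p)      ≡⟨ regroup (z - z ^ 2) R _ s y p ⟩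
  z - z ^ 2 + (R + summand z e)                                 ∎
  where
    g : ℕ → ℤ
    g n = t n * z ^ n

    R s y p : ℤ
    R = sumTo e (summand z)
    s = (- + 1) ^ e
    y = z ^ (2 ℕ.^ e) + + 1
    p = P e z

    double : ∀ k → suc (suc k ℕ.* 2) ≡ suc (suc k) ℕ.+ suc k
    double = ℕ-Ring.solve-∀

    exponent : suc (N e) ≡ 3 ℕ.* 2 ℕ.^ e ℕ.+ 1
    exponent = trans (cong suc (N-closed e)) (+-comm 1 (3 ℕ.* 2 ℕ.^ e))

    regroup : ∀ a r x s y p → a + r + x * (s * y * p) ≡ a + (r + s * x * y * p)
    regroup = ℤ-Ring.solve-∀

lemma2p4 : (e : ℕ) → 1 ≤ e → (z : ℤ) →
    sumTo (suc (3 ℕ.* 2 ℕ.^ e)) (λ n → t n * z ^ n)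
      ≡ z - z ^ 2
        + sumTo e (λ k → (- + 1) ^ k * z ^ (3 ℕ.* 2 ℕ.^ k ℕ.+ 1) * (z ^ (2 ℕ.^ k) + + 1)
                         * prodTo k (λ i → + 1 + z ^ (2 ℕ.^ i) + z ^ (2 ℕ.^ (suc i))))
lemma2p4 e _ z = subst (λ n → sumTo (suc n) (λ n → t n * z ^ n) ≡ z - z ^ 2 + sumTo e (summand z))
                       (N-closed e) (partial-sum e z)
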